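{- Let $k\ge1$ be an integer and $\ell$ an odd integer. Then $\widehat{E}_2|S_{2^k,\ell}|V_2=\frac13\,\widehat{E}_2|S_{2^{k+1},2\ell}$.
   Context: $\widehat{E}_2(\tau)=1-\frac{3}{\pi\operatorname{Im}(\tau)}-24\sum_{n\ge1}\sigma_1(n)q^n$, $q=e^{2\pi i\tau}$, $\sigma_1(n)=\sum_{d\mid n}d$. For $M\in\mathbb{N}$ and $m\in\mathbb{Z}$ not divisible by $M$, $\widehat{E}_2|S_{M,m}(\tau)=-24\sum_{n\ge1,\,n\equiv m\,(M)}\sigma_1(n)q^n$. For a function $g$ on the upper half-plane, $g|V_d(\tau)=g(d\tau)$. -}

module Defs where

open import Data.Nat as ℕ using (ℕ; zero; suc; NonZero)
open import Data.Nat.Divisibility using (_∣?_)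
open import Data.Nat.DivMod using (_/_)
open import Data.List using (upTo; map)
open import Data.Nat.ListAction using (sum)
open import Data.Integer as ℤ using (ℤ; +_; ∣_∣)
open import Data.Rational as ℚ using (ℚ; 0ℚ)
open import Relation.Nullary using (yes; no)

-- sum of divisors σ₁(n) = Σ_{d ∣ n} d  (d ranges over 0..n; d = 0 contributes 0)
σ₁ : ℕ → ℕ
σ₁ n = sum (map (λ d → f d (d ∣? n)) (upTo (suc n)))
  where
  f : (d : ℕ) → _ → ℕ
  f d (yes _) = d
  f d (no _)  = 0

-- A q-series Σ_{n ≥ 0} a(n) qⁿ, represented by its coefficient sequence.
QSeries : Set
QSeries = ℕ → ℚ

-- Ê₂ | S_{M,m}  (for M ∤ m) :  -24 Σ_{n ≥ 1, n ≡ m (mod M)} σ₁(n) qⁿ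
-- n ≡ m (mod M) is expressed as  M ∣ |n - m|.
E2S : ℕ → ℤ → QSeries
E2S M m zero = 0ℚ
E2S M m (suc n) with M ∣? ∣ (+ suc n) ℤ.- m ∣
... | yes _ = ℚ.- ((+ (24 ℕ.* σ₁ (suc n))) ℚ./ 1)
... | no _  = 0ℚ

-- g | V_d (τ) = g(dτ) : on q-expansions, coefficient of qⁿ is a(n/d) if d ∣ n, else 0.
V : (d : ℕ) → .{{NonZero d}} → QSeries → QSeries
V d g n with d ∣? n
... | yes _ = g (n / d)
... | no _  = 0ℚ

-- If m is odd, the divisors of 2m are the divisors e of m together with the 2e, so σ₁(2m) = 3σ₁(m).
-- Applying V₂ keeps the coefficient of q^(n/2) at even n and kills the odd n. On the right, n ≡ 2ℓ
-- (mod 2^(k+1)) already forces n to be even, and for n = 2m it is equivalent to m ≡ ℓ (mod 2^k); since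
-- ℓ is odd and k ≥ 1 such an m is odd, so the coefficients -24σ₁(m) and -24σ₁(2m) differ by the factor 3.
module Submission where

open import Defs
open import Data.Nat as ℕ using (ℕ; _≤_; _^_)
open import Data.Integer as ℤ using (ℤ; +_)
open import Data.Integer.Divisibility as ℤ∣ using ()
open import Data.Rational as ℚ using (ℚ)
open import Relation.Nullary using (¬_)
open import Relation.Binary.PropositionalEquality using (_≡_)

open import Data.Nat using (zero; suc; _+_; _*_; _<_; NonZero)
open import Data.Nat.Properties
  using (*-distribʳ-+; *-comm; *-commutativeSemigroup; m≤n⇒∃[o]m+o≡n; m≤n+m; m≤m*n; m≤n⇒m≤1+n;
         <⇒≱; n<1+n)
open import Data.Nat.Divisibility
  using (_∣_; _∣?_; divides; _∣0; ∣⇒≤; ∣-trans; m∣m*n; m*n∣⇒n∣;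
         *-monoˡ-∣; *-cancelʳ-∣; *-monoʳ-∣; *-cancelˡ-∣)
open import Data.Nat.DivMod using (m*n/n≡m)
open import Data.Nat.Coprimality
  using (Coprime; coprime-+; coprime-divisor; 1-coprimeTo) renaming (sym to Coprime-sym)
open import Data.Nat.Solver using (module +-*-Solver)
open import Algebra.Properties.CommutativeSemigroup *-commutativeSemigroup using (x∙yz≈y∙xz)
open import Data.Nat.ListAction using (sum)
open import Data.Integer using (∣_∣)
open import Data.Integer.Properties using (abs-*; pos-*)
import Data.Integer.Divisibility.Signed as ℤ∣ₛ
open import Data.Integer.Tactic.RingSolver using (solve-∀)
open import Data.Rational using (0ℚ; mkℚ; toℚᵘ)
open import Data.Rational.Properties
  using (normalize-coprime; toℚᵘ-injective; toℚᵘ-homo-*; *-identityˡ; *-assoc; neg-distribʳ-*; *-zeroʳ)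
import Data.Rational.Unnormalised as ℚᵘ
import Data.Rational.Unnormalised.Properties as ℚᵘ
open import Data.List using (map; upTo; applyUpTo)
open import Data.Product using (Σ; proj₁; _,_)
open import Function using (_∘_; id)
open import Relation.Nullary using (yes; no; contradiction)
open import Relation.Binary.PropositionalEquality
  using (refl; sym; trans; cong; cong₂; subst; module ≡-Reasoning)

sumBelow : (ℕ → ℕ) → ℕ → ℕ
sumBelow f zero    = 0
sumBelow f (suc N) = f 0 + sumBelow (f ∘ suc) N

sum-map-applyUpTo : ∀ (f g : ℕ → ℕ) N → sum (map f (applyUpTo g N)) ≡ sumBelow (f ∘ g) N
sum-map-applyUpTo f g zero    = refl
sum-map-applyUpTo f g (suc N) = cong (λ s → f (g 0) + s) (sum-map-applyUpTo f (g ∘ suc) N)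

sumBelow-cong : ∀ {f g} N → (∀ i → f i ≡ g i) → sumBelow f N ≡ sumBelow g N
sumBelow-cong zero    f≗g = refl
sumBelow-cong (suc N) f≗g = cong₂ _+_ (f≗g 0) (sumBelow-cong N (f≗g ∘ suc))

sumBelow-*ʳ : ∀ f c N → sumBelow (λ i → f i * c) N ≡ sumBelow f N * c
sumBelow-*ʳ f c zero    = refl
sumBelow-*ʳ f c (suc N) =
  trans (cong (λ s → f 0 * c + s) (sumBelow-*ʳ (f ∘ suc) c N)) (sym (*-distribʳ-+ c (f 0) _))

sumBelow-zero : ∀ f N → (∀ i → f i ≡ 0) → sumBelow f N ≡ 0
sumBelow-zero f zero    f≗0 = refl
sumBelow-zero f (suc N) f≗0 = cong₂ _+_ (f≗0 0) (sumBelow-zero (f ∘ suc) N (f≗0 ∘ suc))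

sumBelow-+-vanishing : ∀ f N k → (∀ i → N ≤ i → f i ≡ 0) → sumBelow f (N + k) ≡ sumBelow f N
sumBelow-+-vanishing f zero    k vanish = sumBelow-zero f k (λ i → vanish i ℕ.z≤n)
sumBelow-+-vanishing f (suc N) k vanish =
  cong (λ s → f 0 + s) (sumBelow-+-vanishing (f ∘ suc) N k (λ i N≤i → vanish (suc i) (ℕ.s≤s N≤i)))

sumBelow-even+odd : ∀ f N →
  sumBelow f (N * 2) ≡ sumBelow (λ e → f (e * 2)) N + sumBelow (λ e → f (suc (e * 2))) N
sumBelow-even+odd f zero    = refl
sumBelow-even+odd f (suc N) =
  trans (cong (λ s → f 0 + (f 1 + s)) (sumBelow-even+odd (f ∘ suc ∘ suc) N))
        (interchange (f 0) (f 1) _ _)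
  where
  interchange : ∀ a b c d → a + (b + (c + d)) ≡ (a + c) + (b + d)
  interchange = +-*-Solver.solve 4 (λ a b c d → a :+ (b :+ (c :+ d)) := (a :+ c) :+ (b :+ d)) refl
    where open +-*-Solver

-- The summand d ↦ (d if d ∣ n, else 0) of σ₁ n, local to Defs, extracted by unification: σ₁ n then
-- unfolds definitionally to a sum of divisorTerm n.
divisorTerm : ℕ → ℕ → ℕ
divisorTerm n = proj₁ σ₁-as-sum
  where
  σ₁-as-sum : Σ (ℕ → ℕ) λ f → σ₁ n ≡ sum (map f (upTo (suc n)))
  σ₁-as-sum = _ , refl

divisorTerm-> : ∀ {n d} .{{_ : NonZero n}} → n < d → divisorTerm n d ≡ 0
divisorTerm-> {n} {d} n<d with d ∣? n
... | yes d∣n = contradiction (∣⇒≤ d∣n) (<⇒≱ n<d)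
... | no _    = refl

divisorTerm-*ʳ : ∀ m d c .{{_ : NonZero c}} → divisorTerm (m * c) (d * c) ≡ divisorTerm m d * c
divisorTerm-*ʳ m d c with d * c ∣? m * c | d ∣? m
... | yes _    | yes _   = refl
... | no _     | no _    = refl
... | yes dc∣mc | no d∤m = contradiction (*-cancelʳ-∣ c dc∣mc) d∤m
... | no dc∤mc | yes d∣m = contradiction (*-monoˡ-∣ c d∣m) dc∤mc

divisorTerm-coprime : ∀ m d c → Coprime d c → divisorTerm (m * c) d ≡ divisorTerm m d
divisorTerm-coprime m d c d⊥c with d ∣? m * c | d ∣? m
... | yes _    | yes _   = refl
... | no _     | no _    = refl
... | yes d∣mc | no d∤m  = contradiction (coprime-divisor d⊥c (subst (d ∣_) (*-comm m c) d∣mc)) d∤m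
... | no d∤mc  | yes d∣m = contradiction (∣-trans d∣m (m∣m*n c)) d∤mc

divisorTerm-∤ : ∀ m d c → ¬ c ∣ m → divisorTerm m (d * c) ≡ 0
divisorTerm-∤ m d c c∤m with d * c ∣? m
... | yes dc∣m = contradiction (m*n∣⇒n∣ d c dc∣m) c∤m
... | no _     = refl

odd-coprime-2 : ∀ e → Coprime (suc (e * 2)) 2
odd-coprime-2 zero    = 1-coprimeTo 2
odd-coprime-2 (suc e) = coprime-+ (odd-coprime-2 e)

σ₁-sumBelow : ∀ {n} N .{{_ : NonZero n}} → n < N → σ₁ n ≡ sumBelow (divisorTerm n) N
σ₁-sumBelow {n} N n<N with m≤n⇒∃[o]m+o≡n n<N
... | k , refl = begin
  σ₁ n                                ≡⟨ sum-map-applyUpTo (divisorTerm n) id (suc n) ⟩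
  sumBelow (divisorTerm n) (suc n)     ≡⟨ sym (sumBelow-+-vanishing (divisorTerm n) (suc n) k vanish) ⟩
  sumBelow (divisorTerm n) (suc n + k) ∎
  where
  open ≡-Reasoning
  vanish : ∀ d → suc n ≤ d → divisorTerm n d ≡ 0
  vanish d = divisorTerm->

σ₁[m*2]≡3*σ₁[m] : ∀ m → ¬ 2 ∣ m → σ₁ (m * 2) ≡ 3 * σ₁ m
σ₁[m*2]≡3*σ₁[m] zero    2∤m = contradiction (2 ∣0) 2∤m
σ₁[m*2]≡3*σ₁[m] m@(suc _) 2∤m = begin
  σ₁ (m * 2)
    ≡⟨ σ₁-sumBelow (M * 2) (m≤n+m (suc (m * 2)) 1) ⟩
  sumBelow (divisorTerm (m * 2)) (M * 2)
    ≡⟨ sumBelow-even+odd (divisorTerm (m * 2)) M ⟩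
  sumBelow (λ e → divisorTerm (m * 2) (e * 2)) M + sumBelow (λ e → divisorTerm (m * 2) (suc (e * 2))) M
    ≡⟨ cong₂ _+_ (sumBelow-cong M (λ e → divisorTerm-*ʳ m e 2))
                 (sumBelow-cong M (λ e → divisorTerm-coprime m _ 2 (odd-coprime-2 e))) ⟩
  sumBelow (λ e → divisorTerm m e * 2) M + odds
    ≡⟨ cong (_+ odds) (sumBelow-*ʳ (divisorTerm m) 2 M) ⟩
  sumBelow (divisorTerm m) M * 2 + odds
    ≡⟨ cong₂ (λ s t → s * 2 + t) (sym (σ₁-sumBelow M (n<1+n m))) (sym σ₁≡odds) ⟩
  σ₁ m * 2 + σ₁ m
    ≡⟨ +-*-Solver.solve 1 (λ s → s :* con 2 :+ s := con 3 :* s) refl (σ₁ m) ⟩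
  3 * σ₁ m ∎
  where
  open ≡-Reasoning
  open +-*-Solver using (_:+_; _:*_; _:=_; con)
  M = suc m
  odds = sumBelow (λ e → divisorTerm m (suc (e * 2))) M
  σ₁≡odds : σ₁ m ≡ odds
  σ₁≡odds = begin
    σ₁ m                               ≡⟨ σ₁-sumBelow (M * 2) (ℕ.s≤s (m≤n⇒m≤1+n (m≤m*n m 2))) ⟩
    sumBelow (divisorTerm m) (M * 2)   ≡⟨ sumBelow-even+odd (divisorTerm m) M ⟩
    sumBelow (λ e → divisorTerm m (e * 2)) M + odds
      ≡⟨ cong (_+ odds) (sumBelow-zero _ M (λ e → divisorTerm-∤ m e 2 2∤m)) ⟩
    odds                               ∎

∣m*c-c*ℓ∣≡c*∣m-ℓ∣ : ∀ m c ℓ → ∣ + (m * c) ℤ.- + c ℤ.* ℓ ∣ ≡ c * ∣ + m ℤ.- ℓ ∣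
∣m*c-c*ℓ∣≡c*∣m-ℓ∣ m c ℓ = begin
  ∣ + (m * c) ℤ.- + c ℤ.* ℓ ∣     ≡⟨ cong (λ i → ∣ i ℤ.- + c ℤ.* ℓ ∣) (pos-* m c) ⟩
  ∣ + m ℤ.* + c ℤ.- + c ℤ.* ℓ ∣   ≡⟨ cong ∣_∣ (factor (+ m) (+ c) ℓ) ⟩
  ∣ + c ℤ.* (+ m ℤ.- ℓ) ∣         ≡⟨ abs-* (+ c) (+ m ℤ.- ℓ) ⟩
  c * ∣ + m ℤ.- ℓ ∣               ∎
  where
  open ≡-Reasoning
  factor : ∀ i j k → i ℤ.* j ℤ.- j ℤ.* k ≡ j ℤ.* (i ℤ.- k)
  factor = solve-∀

∣m-n∣n⇒∣m : ∀ {i m n} → i ℤ∣ₛ.∣ m ℤ.- n → i ℤ∣ₛ.∣ n → i ℤ∣ₛ.∣ m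
∣m-n∣n⇒∣m {i} {m} {n} i∣m-n i∣n = subst (i ℤ∣ₛ.∣_) (cancel m n) (ℤ∣ₛ.∣m∣n⇒∣m+n i∣m-n i∣n)
  where
  cancel : ∀ a b → a ℤ.- b ℤ.+ b ≡ a
  cancel = solve-∀

∣m-n∣m⇒∣n : ∀ {i m n} → i ℤ∣ₛ.∣ m ℤ.- n → i ℤ∣ₛ.∣ m → i ℤ∣ₛ.∣ n
∣m-n∣m⇒∣n {i} {m} {n} i∣m-n i∣m = subst (i ℤ∣ₛ.∣_) (cancel m n) (ℤ∣ₛ.∣m∣n⇒∣m-n i∣m i∣m-n)
  where
  cancel : ∀ a b → a ℤ.- (a ℤ.- b) ≡ b
  cancel = solve-∀

∣∣n-d*ℓ∣⇒∣n : ∀ d n ℓ → d ∣ ∣ + n ℤ.- + d ℤ.* ℓ ∣ → d ∣ n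
∣∣n-d*ℓ∣⇒∣n d n ℓ d∣n-dℓ =
  ℤ∣ₛ.∣⇒∣ᵤ {+ d} {+ n} (∣m-n∣n⇒∣m (ℤ∣ₛ.∣ᵤ⇒∣ {+ d} {+ n ℤ.- + d ℤ.* ℓ} d∣n-dℓ) (ℤ∣ₛ.∣m⇒∣m*n ℓ ℤ∣ₛ.∣-refl))

∣∣m-ℓ∣⇒∣m⇒∣ℓ : ∀ d m ℓ → d ∣ ∣ + m ℤ.- ℓ ∣ → d ∣ m → d ∣ ∣ ℓ ∣
∣∣m-ℓ∣⇒∣m⇒∣ℓ d m ℓ d∣m-ℓ d∣m =
  ℤ∣ₛ.∣⇒∣ᵤ {+ d} {ℓ} (∣m-n∣m⇒∣n (ℤ∣ₛ.∣ᵤ⇒∣ {+ d} {+ m ℤ.- ℓ} d∣m-ℓ) (ℤ∣ₛ.∣ᵤ⇒∣ {+ d} {+ m} d∣m))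

+n/1≡mkℚ : ∀ n → + n ℚ./ 1 ≡ mkℚ (+ n) 0 (Coprime-sym (1-coprimeTo n))
+n/1≡mkℚ n = normalize-coprime (Coprime-sym (1-coprimeTo n))

+[m*n]/1≡+m/1*+n/1 : ∀ m n → + (m * n) ℚ./ 1 ≡ (+ m ℚ./ 1) ℚ.* (+ n ℚ./ 1)
+[m*n]/1≡+m/1*+n/1 m n = toℚᵘ-injective (begin
  toℚᵘ (+ (m * n) ℚ./ 1)                       ≡⟨ cong toℚᵘ (+n/1≡mkℚ (m * n)) ⟩
  ℚᵘ.mkℚᵘ (+ (m * n)) 0                        ≈⟨ ℚᵘ.*≡* (cong (ℤ._* + 1) (pos-* m n)) ⟩
  ℚᵘ.mkℚᵘ (+ m) 0 ℚᵘ.* ℚᵘ.mkℚᵘ (+ n) 0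
    ≡⟨ sym (cong₂ (λ p q → toℚᵘ p ℚᵘ.* toℚᵘ q) (+n/1≡mkℚ m) (+n/1≡mkℚ n)) ⟩
  toℚᵘ (+ m ℚ./ 1) ℚᵘ.* toℚᵘ (+ n ℚ./ 1)       ≈⟨ ℚᵘ.≃-sym (toℚᵘ-homo-* (+ m ℚ./ 1) (+ n ℚ./ 1)) ⟩
  toℚᵘ ((+ m ℚ./ 1) ℚ.* (+ n ℚ./ 1))            ∎)
  where open ℚᵘ.≃-Reasoning

-a≡⅓*-3a : ∀ a → ℚ.- (+ a ℚ./ 1) ≡ (+ 1 ℚ./ 3) ℚ.* ℚ.- (+ (3 * a) ℚ./ 1)
-a≡⅓*-3a a = begin
  ℚ.- x                      ≡⟨ cong ℚ.-_ (sym (*-identityˡ x)) ⟩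
  ℚ.- ((⅓ ℚ.* three) ℚ.* x)  ≡⟨ cong ℚ.-_ (*-assoc ⅓ three x) ⟩
  ℚ.- (⅓ ℚ.* (three ℚ.* x))  ≡⟨ neg-distribʳ-* ⅓ (three ℚ.* x) ⟩
  ⅓ ℚ.* ℚ.- (three ℚ.* x)    ≡⟨ cong (λ q → ⅓ ℚ.* ℚ.- q) (sym (+[m*n]/1≡+m/1*+n/1 3 a)) ⟩
  ⅓ ℚ.* ℚ.- (+ (3 * a) ℚ./ 1) ∎
  where
  open ≡-Reasoning
  x = + a ℚ./ 1
  ⅓ = + 1 ℚ./ 3
  three = + 3 ℚ./ 1

E2S-∤ : ∀ M m n → ¬ M ∣ ∣ + n ℤ.- m ∣ → E2S M m n ≡ 0ℚ
E2S-∤ M m zero    _   = refl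
E2S-∤ M m (suc n) M∤n-m with M ∣? ∣ + suc n ℤ.- m ∣
... | yes M∣n-m = contradiction M∣n-m M∤n-m
... | no _      = refl

E2S-rescale : ∀ M ℓ → 2 ∣ M → ¬ 2 ∣ ∣ ℓ ∣ → ∀ m →
  E2S M ℓ m ≡ (+ 1 ℚ./ 3) ℚ.* E2S (2 * M) (+ 2 ℤ.* ℓ) (m * 2)
E2S-rescale M ℓ 2∣M 2∤ℓ zero = sym (*-zeroʳ (+ 1 ℚ./ 3))
-- Both tests are split at once: a with-abstraction over a goal that mentions σ₁ (suc m) explicitly
-- normalises it, which is prohibitively expensive.
E2S-rescale M ℓ 2∣M 2∤ℓ (suc m)
  with M ∣? ∣ + suc m ℤ.- ℓ ∣ | 2 * M ∣? ∣ + (suc m * 2) ℤ.- + 2 ℤ.* ℓ ∣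
... | yes M∣m-ℓ | yes _ = begin
  ℚ.- (+ (24 * σ₁ (suc m)) ℚ./ 1)                ≡⟨ -a≡⅓*-3a (24 * σ₁ (suc m)) ⟩
  ⅓ ℚ.* ℚ.- (+ (3 * (24 * σ₁ (suc m))) ℚ./ 1)    ≡⟨ cong (λ a → ⅓ ℚ.* ℚ.- (+ a ℚ./ 1)) σ₁-relation ⟩
  ⅓ ℚ.* ℚ.- (+ (24 * σ₁ (suc m * 2)) ℚ./ 1)      ∎
  where
  open ≡-Reasoning
  ⅓ = + 1 ℚ./ 3
  suc-m-odd : ¬ 2 ∣ suc m
  suc-m-odd = 2∤ℓ ∘ ∣∣m-ℓ∣⇒∣m⇒∣ℓ 2 (suc m) ℓ (∣-trans 2∣M M∣m-ℓ)
  σ₁-relation : 3 * (24 * σ₁ (suc m)) ≡ 24 * σ₁ (suc m * 2)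
  σ₁-relation = begin
    3 * (24 * σ₁ (suc m))  ≡⟨ x∙yz≈y∙xz 3 24 (σ₁ (suc m)) ⟩
    24 * (3 * σ₁ (suc m))  ≡⟨ cong (24 *_) (sym (σ₁[m*2]≡3*σ₁[m] (suc m) suc-m-odd)) ⟩
    24 * σ₁ (suc m * 2)    ∎
... | no _ | no _ = sym (*-zeroʳ (+ 1 ℚ./ 3))
... | yes M∣m-ℓ | no 2M∤2m-2ℓ =
  contradiction (subst (2 * M ∣_) (sym (∣m*c-c*ℓ∣≡c*∣m-ℓ∣ (suc m) 2 ℓ)) (*-monoʳ-∣ 2 M∣m-ℓ)) 2M∤2m-2ℓ
... | no M∤m-ℓ | yes 2M∣2m-2ℓ =
  contradiction (*-cancelˡ-∣ 2 (subst (2 * M ∣_) (∣m*c-c*ℓ∣≡c*∣m-ℓ∣ (suc m) 2 ℓ) 2M∣2m-2ℓ)) M∤m-ℓ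

E2S-odd : ∀ M ℓ n → ¬ 2 ∣ n → E2S (2 * M) (+ 2 ℤ.* ℓ) n ≡ 0ℚ
E2S-odd M ℓ n 2∤n = E2S-∤ (2 * M) (+ 2 ℤ.* ℓ) n (2∤n ∘ ∣∣n-d*ℓ∣⇒∣n 2 n ℓ ∘ ∣-trans (m∣m*n M))

n∣n^k : ∀ n k → 1 ≤ k → n ∣ n ^ k
n∣n^k n (suc k) _ = m∣m*n (n ^ k)

lemma27 : (k : ℕ) → 1 ≤ k → (ℓ : ℤ) → ¬ ((+ 2) ℤ∣.∣ ℓ) →
    (n : ℕ) →
    V 2 (E2S (2 ^ k) ℓ) n
      ≡ ((+ 1) ℚ./ 3) ℚ.* E2S (2 ^ (ℕ.suc k)) ((+ 2) ℤ.* ℓ) n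
lemma27 k 1≤k ℓ 2∤ℓ n with 2 ∣? n
... | yes (divides m refl) =
  trans (cong (E2S (2 ^ k) ℓ) (m*n/n≡m m 2)) (E2S-rescale (2 ^ k) ℓ (n∣n^k 2 k 1≤k) 2∤ℓ m)
... | no 2∤n = sym (trans (cong ((+ 1 ℚ./ 3) ℚ.*_) (E2S-odd (2 ^ k) ℓ n 2∤n)) (*-zeroʳ (+ 1 ℚ./ 3)))
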